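{- Let $\mathcal A^r$ be a theory on $\Sigma^r$ such that for every individual constant $c^\sigma$ of $\Sigma$, $\mathcal A^r\vdash\mathrm{Rel}(c)$. Let $t^\sigma$ be an individual over $\Sigma$ with free variables $\vec x^{\,\vec\tau}$. Then $\mathcal A^r\vdash\forall^r\vec x\,\mathrm{Rel}(t)$.
   Context: Logic. Sorts $\sigma,\tau::=\iota\mid\sigma\to\tau$. A signature $\Sigma$: base sorts, sorted individual constants, sorted predicates each declared negative or positive. Individuals $t::=c^\sigma\mid x^\sigma\mid(t\,u)$. Formulas $P(\vec t)\mid\bot\mid A\Rightarrow B\mid A\wedge B\mid\forall x^\sigma A$. Negative formulas: $N::=P(\vec t)$ ($P$ negative) $\mid\bot\mid A\Rightarrow N\mid N\wedge N'\mid\forall xN$. Sequents $\Gamma\vdash A\mid\Delta$ (all formulas of $\Delta$ negative) are derived by the identity and axiom rules, introduction/elimination rules for $\Rightarrow$, $\wedge$, $\forall$ (with the eigenvariable condition for $\forall$-intro), and the classical rules: from $\Gamma\vdash N\mid\Delta,N$ infer $\Gamma\vdash\bot\mid\Delta,N$, and from $\Gamma\vdash\bot\mid\Delta,N$ infer $\Gamma\vdash N\mid\Delta$. $\mathcal A^r\vdash A$ means $\vdash A\mid$ is derivable using axioms from $\mathcal A^r$. $\Sigma^r$ is $\Sigma$ plus a positive unary predicate $\mathrm{Rel}$ on each base sort; $\mathrm{Rel}(t^{\sigma\to\tau}):=\forall x^\sigma(\mathrm{Rel}(x)\Rightarrow\mathrm{Rel}(t\,x))$; $\forall^rxA:=\forall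 x(\mathrm{Rel}(x)\Rightarrow A)$, and $\forall^r\vec x$ denotes iteration. -}

module Defs where

open import Data.List using (List; []; _∷_; map)
open import Data.List.Membership.Propositional using (_∈_)
open import Relation.Binary.PropositionalEquality using (_≡_)

data Sort (B : Set) : Set where
  base : B → Sort B
  _⇒ˢ_ : Sort B → Sort B → Sort B

data Polarity : Set where
  negative positive : Polarity

record Signature : Set₁ where
  field
    Base     : Set
    Const    : Sort Base → Set
    Pred     : List (Sort Base) → Set
    polarity : ∀ {ar} → Pred ar → Polarity
open Signature public

-- Sorted variables in a context (de Bruijn, head = most recently bound)

data _∋_ {B : Set} : List (Sort B) → Sort B → Set where
  here  : ∀ {Ξ σ} → (σ ∷ Ξ) ∋ σ
  there : ∀ {Ξ σ τ} → Ξ ∋ σ → (τ ∷ Ξ) ∋ σ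

module _ {B : Set} (C : Sort B → Set) where

  data Term (Ξ : List (Sort B)) : Sort B → Set where
    var : ∀ {σ} → Ξ ∋ σ → Term Ξ σ
    con : ∀ {σ} → C σ → Term Ξ σ
    app : ∀ {σ τ} → Term Ξ (σ ⇒ˢ τ) → Term Ξ σ → Term Ξ τ

  data Terms (Ξ : List (Sort B)) : List (Sort B) → Set where
    []  : Terms Ξ []
    _∷_ : ∀ {σ ar} → Term Ξ σ → Terms Ξ ar → Terms Ξ (σ ∷ ar)

module _ {B : Set} where

  Ren : List (Sort B) → List (Sort B) → Set
  Ren Ξ Ξ' = ∀ {σ} → Ξ ∋ σ → Ξ' ∋ σ

  liftRen : ∀ {Ξ Ξ' τ} → Ren Ξ Ξ' → Ren (τ ∷ Ξ) (τ ∷ Ξ')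
  liftRen ρ here      = here
  liftRen ρ (there x) = there (ρ x)

module _ {B : Set} {C : Sort B → Set} where

  renT : ∀ {Ξ Ξ' σ} → Ren Ξ Ξ' → Term C Ξ σ → Term C Ξ' σ
  renT ρ (var x)   = var (ρ x)
  renT ρ (con c)   = con c
  renT ρ (app t u) = app (renT ρ t) (renT ρ u)

  renTs : ∀ {Ξ Ξ' ar} → Ren Ξ Ξ' → Terms C Ξ ar → Terms C Ξ' ar
  renTs ρ []       = []
  renTs ρ (t ∷ ts) = renT ρ t ∷ renTs ρ ts

  wkT : ∀ {Ξ σ τ} → Term C Ξ σ → Term C (τ ∷ Ξ) σ
  wkT = renT there

  Sub : List (Sort B) → List (Sort B) → Set
  Sub Ξ Ξ' = ∀ {σ} → Ξ ∋ σ → Term C Ξ' σ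

  liftSub : ∀ {Ξ Ξ' τ} → Sub Ξ Ξ' → Sub (τ ∷ Ξ) (τ ∷ Ξ')
  liftSub s here      = var here
  liftSub s (there x) = wkT (s x)

  subT : ∀ {Ξ Ξ' σ} → Sub Ξ Ξ' → Term C Ξ σ → Term C Ξ' σ
  subT s (var x)   = s x
  subT s (con c)   = con c
  subT s (app t u) = app (subT s t) (subT s u)

  subTs : ∀ {Ξ Ξ' ar} → Sub Ξ Ξ' → Terms C Ξ ar → Terms C Ξ' ar
  subTs s []       = []
  subTs s (t ∷ ts) = subT s t ∷ subTs s ts

  sub0 : ∀ {Ξ τ} → Term C Ξ τ → Sub (τ ∷ Ξ) Ξ
  sub0 t here      = t
  sub0 t (there x) = var x

module _ (S : Signature) where

  data Formula (Ξ : List (Sort (Base S))) : Set where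
    atom : ∀ {ar} → Pred S ar → Terms (Const S) Ξ ar → Formula Ξ
    ⊥ᶠ   : Formula Ξ
    _⇒_  : Formula Ξ → Formula Ξ → Formula Ξ
    _∧_  : Formula Ξ → Formula Ξ → Formula Ξ
    all  : (σ : Sort (Base S)) → Formula (σ ∷ Ξ) → Formula Ξ

  data Negative {Ξ : List (Sort (Base S))} : Formula Ξ → Set where
    atomN : ∀ {ar} {P : Pred S ar} {ts} → polarity S P ≡ negative → Negative (atom P ts)
    ⊥N    : Negative ⊥ᶠ
    ⇒N    : ∀ {A N} → Negative N → Negative (A ⇒ N)
    ∧N    : ∀ {N N'} → Negative N → Negative N' → Negative (N ∧ N')
    allN  : ∀ {σ N} → Negative N → Negative (all σ N)

module _ {S : Signature} where

  renF : ∀ {Ξ Ξ'} → Ren Ξ Ξ' → Formula S Ξ → Formula S Ξ'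
  renF ρ (atom P ts) = atom P (renTs {C = Const S} ρ ts)
  renF ρ ⊥ᶠ          = ⊥ᶠ
  renF ρ (A ⇒ B)     = renF ρ A ⇒ renF ρ B
  renF ρ (A ∧ B)     = renF ρ A ∧ renF ρ B
  renF ρ (all σ A)   = all σ (renF (liftRen ρ) A)

  subF : ∀ {Ξ Ξ'} → Sub {C = Const S} Ξ Ξ' → Formula S Ξ → Formula S Ξ'
  subF s (atom P ts) = atom P (subTs {C = Const S} s ts)
  subF s ⊥ᶠ          = ⊥ᶠ
  subF s (A ⇒ B)     = subF s A ⇒ subF s B
  subF s (A ∧ B)     = subF s A ∧ subF s B
  subF s (all σ A)   = all σ (subF (liftSub s) A)

  wkF : ∀ {Ξ τ} → Formula S Ξ → Formula S (τ ∷ Ξ)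
  wkF = renF (λ x → there x)

  _[_]ᶠ : ∀ {Ξ τ} → Formula S (τ ∷ Ξ) → Term (Const S) Ξ τ → Formula S Ξ
  A [ t ]ᶠ = subF (sub0 t) A

  closedIn : ∀ {Ξ} → Formula S [] → Formula S Ξ
  closedIn = renF (λ ())

-- Sequents  Γ ⊢ A | Δ  (Δ consists of negative formulas), with axioms
-- taken from a theory Ax (a set of closed formulas).  Derivations live in
-- a context Ξ of (eigen)variables; the eigenvariable condition of
-- ∀-introduction is realised by the fresh de Bruijn variable.

module _ (S : Signature) (Ax : Formula S [] → Set) where

  data Deriv {Ξ : List (Sort (Base S))} :
         List (Formula S Ξ) → Formula S Ξ → List (Formula S Ξ) → Set where
    idR   : ∀ {Γ Δ A} → A ∈ Γ → Deriv Γ A Δ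
    axR   : ∀ {Γ Δ A} → Ax A → Deriv Γ (closedIn A) Δ
    ⇒I    : ∀ {Γ Δ A B} → Deriv (A ∷ Γ) B Δ → Deriv Γ (A ⇒ B) Δ
    ⇒E    : ∀ {Γ Δ A B} → Deriv Γ (A ⇒ B) Δ → Deriv Γ A Δ → Deriv Γ B Δ
    ∧I    : ∀ {Γ Δ A B} → Deriv Γ A Δ → Deriv Γ B Δ → Deriv Γ (A ∧ B) Δ
    ∧E₁   : ∀ {Γ Δ A B} → Deriv Γ (A ∧ B) Δ → Deriv Γ A Δ
    ∧E₂   : ∀ {Γ Δ A B} → Deriv Γ (A ∧ B) Δ → Deriv Γ B Δ
    ∀I    : ∀ {Γ Δ σ A} → Deriv {σ ∷ Ξ} (map wkF Γ) A (map wkF Δ) → Deriv Γ (all σ A) Δ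
    ∀E    : ∀ {Γ Δ σ A} → Deriv Γ (all σ A) Δ → (t : Term (Const S) Ξ σ) → Deriv Γ (A [ t ]ᶠ) Δ
    classic₁ : ∀ {Γ Δ N} → Negative S N → N ∈ Δ → Deriv Γ N Δ → Deriv Γ ⊥ᶠ Δ
    classic₂ : ∀ {Γ Δ N} → Negative S N → Deriv Γ ⊥ᶠ (N ∷ Δ) → Deriv Γ N Δ

  Provable : Formula S [] → Set
  Provable A = Deriv {[]} [] A []

module _ (S : Signature) where

  data RelPred : List (Sort (Base S)) → Set where
    orig : ∀ {ar} → Pred S ar → RelPred ar
    rel  : (b : Base S) → RelPred (base b ∷ [])

  relPolarity : ∀ {ar} → RelPred ar → Polarity
  relPolarity (orig P) = polarity S P
  relPolarity (rel b)  = positive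

  Sigʳ : Signature
  Sigʳ = record { Base = Base S ; Const = Const S ; Pred = RelPred ; polarity = relPolarity }

module _ {S : Signature} where

  Rel : ∀ {Ξ σ} → Term (Const S) Ξ σ → Formula (Sigʳ S) Ξ
  Rel {σ = base b}   t = atom (rel b) (t ∷ [])
  Rel {σ = σ ⇒ˢ τ}   t = all σ (Rel (var here) ⇒ Rel (app (wkT t) (var here)))

  ∀ʳ : ∀ {Ξ} (σ : Sort (Base S)) → Formula (Sigʳ S) (σ ∷ Ξ) → Formula (Sigʳ S) Ξ
  ∀ʳ σ A = all σ (Rel {σ = σ} (var here) ⇒ A)

  ∀ʳ* : (Ξ : List (Sort (Base S))) → Formula (Sigʳ S) Ξ → Formula (Sigʳ S) []
  ∀ʳ* []      A = A
  ∀ʳ* (σ ∷ Ξ) A = ∀ʳ* Ξ (∀ʳ σ A)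

module Submission where

-- Under the hypotheses Rel(x) for the free variables x⃗ of t, Rel(t) is derivable by induction
-- on t: a variable is a hypothesis, a constant is covered by the assumption on 𝒜ʳ (weakened
-- from the empty context), and for an application t u the formula Rel(t) is by definition
-- ∀y (Rel(y) ⇒ Rel(t y)), which we instantiate at u and apply to Rel(u).  Discharging the
-- hypotheses and generalising the variables one by one gives ∀ʳx⃗ Rel(t).

open import Defs
open import Data.List using (List; []; _∷_; map)
open import Data.List.Properties using (map-∘; map-cong)
open import Data.List.Membership.Propositional using (_∈_)
open import Data.List.Membership.Propositional.Properties using (∈-map⁺; ∈-map⁻)
open import Data.List.Relation.Unary.Any using (here; there)
open import Data.Product using (_,_)
open import Relation.Binary.PropositionalEquality
  using (_≡_; refl; sym; trans; cong; cong₂; subst; module ≡-Reasoning)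

module _ {B : Set} where

  _≗ᴿ_ : ∀ {Ξ Ξ'} → Ren {B} Ξ Ξ' → Ren Ξ Ξ' → Set
  ρ ≗ᴿ ρ' = ∀ {σ} (x : _ ∋ σ) → ρ x ≡ ρ' x

  liftRen-cong : ∀ {Ξ Ξ' τ} {ρ ρ' : Ren {B} Ξ Ξ'} → ρ ≗ᴿ ρ' → liftRen {τ = τ} ρ ≗ᴿ liftRen ρ'
  liftRen-cong e here      = refl
  liftRen-cong e (there x) = cong there (e x)

  liftRen-∘ : ∀ {Ξ Ξ' Ξ'' τ} (ρ : Ren {B} Ξ Ξ') (ρ' : Ren Ξ' Ξ'') →
    (λ x → liftRen {τ = τ} ρ' (liftRen ρ x)) ≗ᴿ liftRen (λ x → ρ' (ρ x))
  liftRen-∘ ρ ρ' here      = refl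
  liftRen-∘ ρ ρ' (there x) = refl

module _ {B : Set} {C : Sort B → Set} where

  _≗ˢ_ : ∀ {Ξ Ξ'} → Sub {C = C} Ξ Ξ' → Sub Ξ Ξ' → Set
  s ≗ˢ s' = ∀ {σ} (x : _ ∋ σ) → s x ≡ s' x

  renT-cong : ∀ {Ξ Ξ' σ} {ρ ρ' : Ren Ξ Ξ'} → ρ ≗ᴿ ρ' → (t : Term C Ξ σ) → renT ρ t ≡ renT ρ' t
  renT-cong e (var x)   = cong var (e x)
  renT-cong e (con c)   = refl
  renT-cong e (app t u) = cong₂ app (renT-cong e t) (renT-cong e u)

  renT-∘ : ∀ {Ξ Ξ' Ξ'' σ} (ρ : Ren Ξ Ξ') (ρ' : Ren Ξ' Ξ'') (t : Term C Ξ σ) →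
    renT ρ' (renT ρ t) ≡ renT (λ x → ρ' (ρ x)) t
  renT-∘ ρ ρ' (var x)   = refl
  renT-∘ ρ ρ' (con c)   = refl
  renT-∘ ρ ρ' (app t u) = cong₂ app (renT-∘ ρ ρ' t) (renT-∘ ρ ρ' u)

  subT-cong : ∀ {Ξ Ξ' σ} {s s' : Sub Ξ Ξ'} → s ≗ˢ s' → (t : Term C Ξ σ) → subT s t ≡ subT s' t
  subT-cong e (var x)   = e x
  subT-cong e (con c)   = refl
  subT-cong e (app t u) = cong₂ app (subT-cong e t) (subT-cong e u)

  subT-renT : ∀ {Ξ Ξ' Ξ'' σ} (ρ : Ren Ξ Ξ') (s : Sub Ξ' Ξ'') (t : Term C Ξ σ) →
    subT s (renT ρ t) ≡ subT (λ x → s (ρ x)) t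
  subT-renT ρ s (var x)   = refl
  subT-renT ρ s (con c)   = refl
  subT-renT ρ s (app t u) = cong₂ app (subT-renT ρ s t) (subT-renT ρ s u)

  renT-subT : ∀ {Ξ Ξ' Ξ'' σ} (s : Sub Ξ Ξ') (ρ : Ren Ξ' Ξ'') (t : Term C Ξ σ) →
    renT ρ (subT s t) ≡ subT (λ x → renT ρ (s x)) t
  renT-subT s ρ (var x)   = refl
  renT-subT s ρ (con c)   = refl
  renT-subT s ρ (app t u) = cong₂ app (renT-subT s ρ t) (renT-subT s ρ u)

  subT-var : ∀ {Ξ σ} (t : Term C Ξ σ) → subT var t ≡ t
  subT-var (var x)   = refl
  subT-var (con c)   = refl
  subT-var (app t u) = cong₂ app (subT-var t) (subT-var u)

  liftSub-cong : ∀ {Ξ Ξ' τ} {s s' : Sub Ξ Ξ'} → s ≗ˢ s' → liftSub {τ = τ} s ≗ˢ liftSub s'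
  liftSub-cong e here      = refl
  liftSub-cong e (there x) = cong wkT (e x)

  renT-liftRen-wkT : ∀ {Ξ Ξ' σ τ} (ρ : Ren Ξ Ξ') (t : Term C Ξ σ) →
    renT (liftRen {τ = τ} ρ) (wkT t) ≡ wkT (renT ρ t)
  renT-liftRen-wkT ρ t = trans (renT-∘ there (liftRen ρ) t) (sym (renT-∘ ρ there t))

  subT-liftSub-wkT : ∀ {Ξ Ξ' σ τ} (s : Sub Ξ Ξ') (t : Term C Ξ σ) →
    subT (liftSub {τ = τ} s) (wkT t) ≡ wkT (subT s t)
  subT-liftSub-wkT s t = trans (subT-renT there (liftSub s) t) (sym (renT-subT s there t))

  subT-sub0-wkT : ∀ {Ξ σ τ} (u : Term C Ξ τ) (t : Term C Ξ σ) → subT (sub0 u) (wkT t) ≡ t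
  subT-sub0-wkT u t = trans (subT-renT there (sub0 u) t) (subT-var t)

  renTs-cong : ∀ {Ξ Ξ' ar} {ρ ρ' : Ren Ξ Ξ'} → ρ ≗ᴿ ρ' → (ts : Terms C Ξ ar) →
    renTs ρ ts ≡ renTs ρ' ts
  renTs-cong e []       = refl
  renTs-cong e (t ∷ ts) = cong₂ _∷_ (renT-cong e t) (renTs-cong e ts)

  renTs-∘ : ∀ {Ξ Ξ' Ξ'' ar} (ρ : Ren Ξ Ξ') (ρ' : Ren Ξ' Ξ'') (ts : Terms C Ξ ar) →
    renTs ρ' (renTs ρ ts) ≡ renTs (λ x → ρ' (ρ x)) ts
  renTs-∘ ρ ρ' []       = refl
  renTs-∘ ρ ρ' (t ∷ ts) = cong₂ _∷_ (renT-∘ ρ ρ' t) (renTs-∘ ρ ρ' ts)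

  subTs-cong : ∀ {Ξ Ξ' ar} {s s' : Sub Ξ Ξ'} → s ≗ˢ s' → (ts : Terms C Ξ ar) →
    subTs s ts ≡ subTs s' ts
  subTs-cong e []       = refl
  subTs-cong e (t ∷ ts) = cong₂ _∷_ (subT-cong e t) (subTs-cong e ts)

  subTs-renTs : ∀ {Ξ Ξ' Ξ'' ar} (ρ : Ren Ξ Ξ') (s : Sub Ξ' Ξ'') (ts : Terms C Ξ ar) →
    subTs s (renTs ρ ts) ≡ subTs (λ x → s (ρ x)) ts
  subTs-renTs ρ s []       = refl
  subTs-renTs ρ s (t ∷ ts) = cong₂ _∷_ (subT-renT ρ s t) (subTs-renTs ρ s ts)

  renTs-subTs : ∀ {Ξ Ξ' Ξ'' ar} (s : Sub Ξ Ξ') (ρ : Ren Ξ' Ξ'') (ts : Terms C Ξ ar) →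
    renTs ρ (subTs s ts) ≡ subTs (λ x → renT ρ (s x)) ts
  renTs-subTs s ρ []       = refl
  renTs-subTs s ρ (t ∷ ts) = cong₂ _∷_ (renT-subT s ρ t) (renTs-subTs s ρ ts)

module _ {S : Signature} where

  renF-cong : ∀ {Ξ Ξ'} {ρ ρ' : Ren Ξ Ξ'} → ρ ≗ᴿ ρ' → (A : Formula S Ξ) → renF ρ A ≡ renF ρ' A
  renF-cong e (atom P ts) = cong (atom P) (renTs-cong e ts)
  renF-cong e ⊥ᶠ          = refl
  renF-cong e (A ⇒ B)     = cong₂ _⇒_ (renF-cong e A) (renF-cong e B)
  renF-cong e (A ∧ B)     = cong₂ _∧_ (renF-cong e A) (renF-cong e B)
  renF-cong e (all σ A)   = cong (all σ) (renF-cong (liftRen-cong e) A)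

  renF-∘ : ∀ {Ξ Ξ' Ξ''} (ρ : Ren Ξ Ξ') (ρ' : Ren Ξ' Ξ'') (A : Formula S Ξ) →
    renF ρ' (renF ρ A) ≡ renF (λ x → ρ' (ρ x)) A
  renF-∘ ρ ρ' (atom P ts) = cong (atom P) (renTs-∘ ρ ρ' ts)
  renF-∘ ρ ρ' ⊥ᶠ          = refl
  renF-∘ ρ ρ' (A ⇒ B)     = cong₂ _⇒_ (renF-∘ ρ ρ' A) (renF-∘ ρ ρ' B)
  renF-∘ ρ ρ' (A ∧ B)     = cong₂ _∧_ (renF-∘ ρ ρ' A) (renF-∘ ρ ρ' B)
  renF-∘ ρ ρ' (all σ A)   =
    cong (all σ) (trans (renF-∘ (liftRen ρ) (liftRen ρ') A) (renF-cong (liftRen-∘ ρ ρ') A))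

  subF-cong : ∀ {Ξ Ξ'} {s s' : Sub Ξ Ξ'} → s ≗ˢ s' → (A : Formula S Ξ) → subF s A ≡ subF s' A
  subF-cong e (atom P ts) = cong (atom P) (subTs-cong e ts)
  subF-cong e ⊥ᶠ          = refl
  subF-cong e (A ⇒ B)     = cong₂ _⇒_ (subF-cong e A) (subF-cong e B)
  subF-cong e (A ∧ B)     = cong₂ _∧_ (subF-cong e A) (subF-cong e B)
  subF-cong e (all σ A)   = cong (all σ) (subF-cong (liftSub-cong e) A)

  subF-renF : ∀ {Ξ Ξ' Ξ''} (ρ : Ren Ξ Ξ') (s : Sub Ξ' Ξ'') (A : Formula S Ξ) →
    subF s (renF ρ A) ≡ subF (λ x → s (ρ x)) A
  subF-renF ρ s (atom P ts) = cong (atom P) (subTs-renTs ρ s ts)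
  subF-renF ρ s ⊥ᶠ          = refl
  subF-renF ρ s (A ⇒ B)     = cong₂ _⇒_ (subF-renF ρ s A) (subF-renF ρ s B)
  subF-renF ρ s (A ∧ B)     = cong₂ _∧_ (subF-renF ρ s A) (subF-renF ρ s B)
  subF-renF ρ s (all σ A)   = cong (all σ) (trans (subF-renF (liftRen ρ) (liftSub s) A)
    (subF-cong (λ { here → refl ; (there x) → refl }) A))

  renF-subF : ∀ {Ξ Ξ' Ξ''} (s : Sub Ξ Ξ') (ρ : Ren Ξ' Ξ'') (A : Formula S Ξ) →
    renF ρ (subF s A) ≡ subF (λ x → renT ρ (s x)) A
  renF-subF s ρ (atom P ts) = cong (atom P) (renTs-subTs s ρ ts)
  renF-subF s ρ ⊥ᶠ          = refl
  renF-subF s ρ (A ⇒ B)     = cong₂ _⇒_ (renF-subF s ρ A) (renF-subF s ρ B)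
  renF-subF s ρ (A ∧ B)     = cong₂ _∧_ (renF-subF s ρ A) (renF-subF s ρ B)
  renF-subF s ρ (all σ A)   = cong (all σ) (trans (renF-subF (liftSub s) (liftRen ρ) A)
    (subF-cong (λ { here → refl ; (there x) → renT-liftRen-wkT ρ (s x) }) A))

  renF-[]ᶠ : ∀ {Ξ Ξ' τ} (ρ : Ren Ξ Ξ') (A : Formula S (τ ∷ Ξ)) (t : Term (Const S) Ξ τ) →
    renF ρ (A [ t ]ᶠ) ≡ renF (liftRen ρ) A [ renT ρ t ]ᶠ
  renF-[]ᶠ ρ A t = begin
    renF ρ (subF (sub0 t) A)                         ≡⟨ renF-subF (sub0 t) ρ A ⟩
    subF (λ x → renT ρ (sub0 t x)) A                 ≡⟨ subF-cong (λ { here → refl ; (there x) → refl }) A ⟩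
    subF (λ x → sub0 (renT ρ t) (liftRen ρ x)) A     ≡⟨ subF-renF (liftRen ρ) (sub0 (renT ρ t)) A ⟨
    subF (sub0 (renT ρ t)) (renF (liftRen ρ) A)      ∎
    where open ≡-Reasoning

  renF-liftRen-wkF : ∀ {Ξ Ξ' τ} (ρ : Ren Ξ Ξ') (A : Formula S Ξ) →
    renF (liftRen {τ = τ} ρ) (wkF A) ≡ wkF (renF ρ A)
  renF-liftRen-wkF ρ A = trans (renF-∘ there (liftRen ρ) A) (sym (renF-∘ ρ there A))

  renF-closedIn : ∀ {Ξ Ξ'} (ρ : Ren Ξ Ξ') (A : Formula S []) → renF ρ (closedIn A) ≡ closedIn A
  renF-closedIn ρ A = trans (renF-∘ (λ ()) ρ A) (renF-cong (λ ()) A)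

  Negative-renF : ∀ {Ξ Ξ'} (ρ : Ren Ξ Ξ') {N : Formula S Ξ} → Negative S N → Negative S (renF ρ N)
  Negative-renF ρ (atomN p) = atomN p
  Negative-renF ρ ⊥N        = ⊥N
  Negative-renF ρ (⇒N n)    = ⇒N (Negative-renF ρ n)
  Negative-renF ρ (∧N n m)  = ∧N (Negative-renF ρ n) (Negative-renF ρ m)
  Negative-renF ρ (allN n)  = allN (Negative-renF (liftRen ρ) n)

module _ {S : Signature} {Ax : Formula S [] → Set} where

  private
    castᶠ : ∀ {Ξ} {Γ : List (Formula S Ξ)} {A A' Δ} → A ≡ A' → Deriv S Ax Γ A Δ → Deriv S Ax Γ A' Δ
    castᶠ = subst (λ X → Deriv S Ax _ X _)

  renD : ∀ {Ξ Ξ'} (ρ : Ren Ξ Ξ') {Γ A Δ} {Γ' : List (Formula S Ξ')} →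
    (∀ {B} → B ∈ Γ → renF ρ B ∈ Γ') →
    Deriv S Ax Γ A Δ → Deriv S Ax Γ' (renF ρ A) (map (renF ρ) Δ)
  renD ρ h (idR m)            = idR (h m)
  renD ρ h (axR {A = A} a)    = castᶠ (sym (renF-closedIn ρ A)) (axR a)
  renD ρ h (⇒I d)             = ⇒I (renD ρ (λ { (here refl) → here refl ; (there m) → there (h m) }) d)
  renD ρ h (⇒E d e)           = ⇒E (renD ρ h d) (renD ρ h e)
  renD ρ h (∧I d e)           = ∧I (renD ρ h d) (renD ρ h e)
  renD ρ h (∧E₁ d)            = ∧E₁ (renD ρ h d)
  renD ρ h (∧E₂ d)            = ∧E₂ (renD ρ h d)
  renD ρ {Γ} {Δ = Δ} {Γ'} h (∀I d) =
    ∀I (subst (Deriv S Ax _ _) wk-comm (renD (liftRen ρ) h↑ d))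
    where
    wk-comm : map (renF (liftRen ρ)) (map wkF Δ) ≡ map wkF (map (renF ρ) Δ)
    wk-comm = trans (sym (map-∘ Δ)) (trans (map-cong (renF-liftRen-wkF ρ) Δ) (map-∘ Δ))

    h↑ : ∀ {B} → B ∈ map wkF Γ → renF (liftRen ρ) B ∈ map wkF Γ'
    h↑ m with ∈-map⁻ wkF m
    ... | B , m₀ , refl = subst (_∈ map wkF Γ') (sym (renF-liftRen-wkF ρ B)) (∈-map⁺ wkF (h m₀))
  renD ρ h (∀E {A = A} d t)   = castᶠ (sym (renF-[]ᶠ ρ A t)) (∀E (renD ρ h d) (renT ρ t))
  renD ρ h (classic₁ n m d)   = classic₁ (Negative-renF ρ n) (∈-map⁺ (renF ρ) m) (renD ρ h d)
  renD ρ h (classic₂ n d)     = classic₂ (Negative-renF ρ n) (renD ρ h d)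

module _ {S : Signature} where

  Rel-renF : ∀ {Ξ Ξ' σ} (ρ : Ren Ξ Ξ') (t : Term (Const S) Ξ σ) →
    renF {S = Sigʳ S} ρ (Rel t) ≡ Rel (renT ρ t)
  Rel-renF {σ = base b}  ρ t = refl
  Rel-renF {σ = σ ⇒ˢ τ} ρ t = cong (all σ) (cong₂ _⇒_ (Rel-renF (liftRen ρ) (var here))
    (trans (Rel-renF (liftRen ρ) (app (wkT t) (var here)))
           (cong (λ u → Rel (app u (var here))) (renT-liftRen-wkT ρ t))))

  Rel-subF : ∀ {Ξ Ξ' σ} (s : Sub Ξ Ξ') (t : Term (Const S) Ξ σ) →
    subF {S = Sigʳ S} s (Rel t) ≡ Rel (subT s t)
  Rel-subF {σ = base b}  s t = refl
  Rel-subF {σ = σ ⇒ˢ τ} s t = cong (all σ) (cong₂ _⇒_ (Rel-subF (liftSub s) (var here))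
    (trans (Rel-subF (liftSub s) (app (wkT t) (var here)))
           (cong (λ u → Rel (app u (var here))) (subT-liftSub-wkT s t))))

  Rel-[]ᶠ : ∀ {Ξ σ τ} (t : Term (Const S) Ξ (σ ⇒ˢ τ)) (u : Term (Const S) Ξ σ) →
    Rel (app (wkT t) (var here)) [ u ]ᶠ ≡ Rel (app t u)
  Rel-[]ᶠ t u = trans (Rel-subF (sub0 u) (app (wkT t) (var here)))
                      (cong (λ v → Rel (app v u)) (subT-sub0-wkT u t))

  RelHyps : (Ξ : List (Sort (Base S))) → List (Formula (Sigʳ S) Ξ)
  RelHyps []      = []
  RelHyps (σ ∷ Ξ) = Rel (var here) ∷ map wkF (RelHyps Ξ)

  Rel-var∈RelHyps : ∀ {Ξ σ} (x : Ξ ∋ σ) → Rel (var x) ∈ RelHyps Ξ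
  Rel-var∈RelHyps here              = here refl
  Rel-var∈RelHyps {σ ∷ Ξ} (there x) =
    there (subst (_∈ map wkF (RelHyps Ξ)) (Rel-renF there (var x)) (∈-map⁺ wkF (Rel-var∈RelHyps x)))

module _ {S : Signature} {Ax : Formula (Sigʳ S) [] → Set} where

  private
    _⊢ʳ_ : ∀ {Ξ} → List (Formula (Sigʳ S) Ξ) → Formula (Sigʳ S) Ξ → Set
    Γ ⊢ʳ A = Deriv (Sigʳ S) Ax Γ A []

  Rel-con-weaken : ∀ {Ξ σ} (c : Const S σ) → Provable (Sigʳ S) Ax (Rel (con c)) →
    RelHyps Ξ ⊢ʳ Rel (con c)
  Rel-con-weaken c d = subst (RelHyps _ ⊢ʳ_) (Rel-renF (λ ()) (con c)) (renD (λ ()) (λ ()) d)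

  Rel-app : ∀ {Ξ σ τ} {Γ : List (Formula (Sigʳ S) Ξ)}
    (t : Term (Const S) Ξ (σ ⇒ˢ τ)) (u : Term (Const S) Ξ σ) →
    Γ ⊢ʳ Rel t → Γ ⊢ʳ Rel u → Γ ⊢ʳ Rel (app t u)
  Rel-app t u dt du =
    subst (_ ⊢ʳ_) (Rel-[]ᶠ t u)
      (⇒E (∀E dt u) (subst (_ ⊢ʳ_) (sym (Rel-subF (sub0 u) (var here))) du))

  ∀ʳ*-intro : ∀ Ξ {A} → RelHyps Ξ ⊢ʳ A → Provable (Sigʳ S) Ax (∀ʳ* Ξ A)
  ∀ʳ*-intro []      d = d
  ∀ʳ*-intro (σ ∷ Ξ) d = ∀ʳ*-intro Ξ (∀I (⇒I d))

mainTheorem9 : (S : Signature) (Ax : Formula (Sigʳ S) [] → Set) →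
    (∀ {σ} (c : Const S σ) → Provable (Sigʳ S) Ax (Rel {Ξ = []} (con c))) →
    ∀ {Ξ σ} (t : Term (Const S) Ξ σ) → Provable (Sigʳ S) Ax (∀ʳ* Ξ (Rel t))
mainTheorem9 S Ax Rel-con {Ξ} t = ∀ʳ*-intro Ξ (Rel-term t)
  where
  Rel-term : ∀ {Ξ σ} (t : Term (Const S) Ξ σ) → Deriv (Sigʳ S) Ax (RelHyps Ξ) (Rel t) []
  Rel-term (var x)   = idR (Rel-var∈RelHyps x)
  Rel-term (con c)   = Rel-con-weaken c (Rel-con c)
  Rel-term (app t u) = Rel-app t u (Rel-term t) (Rel-term u)
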